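{- Let $G$ be a graph, $A\subseteq V(G)$, and $d\ge1$, $k\ge 0$ integers. Assume that for every $S\subseteq A$ there exists $R\subseteq S$ with $|R|\le k$ and $N(S)\cap\overline{A}=N(R)\cap\overline{A}$. Then for every $S\subseteq A$ there exists $R'\subseteq S$ with $|R'|\le dk$ and $R'\equiv^d_A S$.
   Context: $\overline{A}=V(G)\setminus A$ and $N(X)=\bigcup_{x\in X}N(x)$. For $X,X'\subseteq A$, $X\equiv^d_A X'$ ($d$-neighbour equivalence w.r.t. $A$) means: for every $v\in\overline{A}$, either $|N(v)\cap X|=|N(v)\cap X'|$, or both $|N(v)\cap X|\ge d$ and $|N(v)\cap X'|\ge d$. -}

module Defs where

open import Data.Nat using (ℕ; _≤_; _*_)
open import Data.Bool using (Bool; true; false; _∧_)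
open import Data.Fin using (Fin)
open import Data.Fin.Subset using (Subset; _∩_; ∁; ∣_∣; _∈_)
open import Data.Vec using (tabulate; lookup)
open import Data.Vec.Functional using () renaming (foldr to foldrF)
open import Data.Bool using (_∨_)
open import Data.Product using (_×_)
open import Relation.Binary.PropositionalEquality using (_≡_)
open import Relation.Nullary using (¬_)

record Graph : Set where
  field
    n     : ℕ
    adj   : Fin n → Fin n → Bool
    sym   : ∀ u v → adj u v ≡ adj v u
    irrefl : ∀ v → adj v v ≡ false

open Graph public

V : Graph → Set
V G = Fin (n G)

N₁ : (G : Graph) → V G → Subset (n G)
N₁ G v = tabulate (adj G v)

N : (G : Graph) → Subset (n G) → Subset (n G)
N G X = tabulate λ u → foldrF (λ b acc → b ∨ acc) false (λ x → lookup X x ∧ adj G x u)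

open import Data.Sum using (_⊎_)

NeighbourEquiv : (G : Graph) (d : ℕ) (A X X' : Subset (n G)) → Set
NeighbourEquiv G d A X X' =
  ∀ (v : V G) → v ∈ ∁ A →
    (∣ N₁ G v ∩ X ∣ ≡ ∣ N₁ G v ∩ X' ∣)
    ⊎ (d ≤ ∣ N₁ G v ∩ X ∣ × d ≤ ∣ N₁ G v ∩ X' ∣)

module Submission where

-- Call R' a "d-saturating" subset of S (relative to A) when every
-- vertex v outside A either has all of its S-neighbours inside R', or has at
-- least d neighbours in R'.  A d-saturating R' ⊆ S is d-neighbour equivalent
-- to S: in the first case N(v) ∩ R' = N(v) ∩ S, in the second both counts are
-- at least d.  So it suffices to build a d-saturating subset of size ≤ d·k.
--
-- This is done by induction on d, peeling off representatives.  Given S ⊆ A,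
-- the hypothesis yields R ⊆ S with |R| ≤ k and N(S) ∩ Ā = N(R) ∩ Ā; by
-- induction S ∖ R has a d-saturating subset R₁ of size ≤ d·k.  Then R ∪ R₁ is
-- (d+1)-saturating for S: a vertex v ∉ A with an S-neighbour lies in N(S) ∩ Ā,
-- hence has a neighbour in R, which is a (d+1)-st neighbour beyond those in R₁.

open import Defs
open import Data.Nat using (ℕ; zero; suc; _+_; _≤_; _*_; z≤n; s≤s)
open import Data.Nat.Properties using (≤-trans; ≤-reflexive; +-mono-≤; +-suc; m≤n⇒m≤1+n)
open import Data.Bool using (Bool; true; false; _∧_; _∨_)
open import Data.Fin using (Fin; zero; suc)
open import Data.Fin.Subset
  using (Subset; inside; outside; _⊆_; _⊂_; _∩_; _∪_; ∁; ∣_∣; _∈_; _∉_; ⊥; Nonempty)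
open import Data.Fin.Subset.Properties
  using ( x∈p∩q⁺; x∈p∩q⁻; x∈p∪q⁺; x∈p∪q⁻; p∩q⊆p; q⊆p∪q; _∈?_; ⊥⊆; ∣⊥∣≡0; ⊆-antisym
        ; p⊆q⇒∣p∣≤∣q∣; p⊂q⇒∣p∣<∣q∣; x∈∁p⇒x∉p; x∉p⇒x∈∁p; nonempty? )
open import Data.Vec using (_∷_; []; tabulate; lookup)
open import Data.Vec.Properties using ([]=⇒lookup; lookup⇒[]=; lookup∘tabulate)
open import Data.Vec.Functional using () renaming (foldr to foldrF)
open import Data.Product using (Σ; ∃; _×_; _,_; proj₁; proj₂)
open import Data.Sum using (_⊎_; inj₁; inj₂; [_,_]′)
open import Relation.Nullary using (yes; no; contradiction)
open import Function using (_∘_)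
open import Relation.Binary.PropositionalEquality
  using (_≡_; refl; trans; cong; subst) renaming (sym to ≡-sym)

∣p∪q∣≤∣p∣+∣q∣ : ∀ {m} (p q : Subset m) → ∣ p ∪ q ∣ ≤ ∣ p ∣ + ∣ q ∣
∣p∪q∣≤∣p∣+∣q∣ []            []            = z≤n
∣p∪q∣≤∣p∣+∣q∣ (outside ∷ p) (outside ∷ q) = ∣p∪q∣≤∣p∣+∣q∣ p q
∣p∪q∣≤∣p∣+∣q∣ (inside  ∷ p) (outside ∷ q) = s≤s (∣p∪q∣≤∣p∣+∣q∣ p q)
∣p∪q∣≤∣p∣+∣q∣ (outside ∷ p) (inside  ∷ q) =
  subst (suc ∣ p ∪ q ∣ ≤_) (≡-sym (+-suc ∣ p ∣ ∣ q ∣)) (s≤s (∣p∪q∣≤∣p∣+∣q∣ p q))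
∣p∪q∣≤∣p∣+∣q∣ (inside  ∷ p) (inside  ∷ q) =
  s≤s (subst (∣ p ∪ q ∣ ≤_) (≡-sym (+-suc ∣ p ∣ ∣ q ∣)) (m≤n⇒m≤1+n (∣p∪q∣≤∣p∣+∣q∣ p q)))

∩-monoʳ-⊆ : ∀ {m} (p : Subset m) {q r : Subset m} → q ⊆ r → p ∩ q ⊆ p ∩ r
∩-monoʳ-⊆ p {q} q⊆r x∈ = x∈p∩q⁺ (proj₁ (x∈p∩q⁻ p q x∈) , q⊆r (proj₂ (x∈p∩q⁻ p q x∈)))

∩-⊆-∪ : ∀ {m} (p q : Subset m) {r s : Subset m} → p ∩ (q ∩ ∁ r) ⊆ s → p ∩ q ⊆ r ∪ s
∩-⊆-∪ p q {r} p∩q∖r⊆s {x} x∈ with x∈p∩q⁻ p q x∈ | x ∈? r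
... | _         | yes x∈r = x∈p∪q⁺ (inj₁ x∈r)
... | x∈p , x∈q | no  x∉r =
  x∈p∪q⁺ (inj₂ (p∩q∖r⊆s (x∈p∩q⁺ (x∈p , x∈p∩q⁺ (x∈q , x∉p⇒x∈∁p x∉r)))))

∈tabulate⁺ : ∀ {m} (f : Fin m → Bool) {i : Fin m} → f i ≡ true → i ∈ tabulate f
∈tabulate⁺ f {i} fi = lookup⇒[]= i (tabulate f) (trans (lookup∘tabulate f i) fi)

∈tabulate⁻ : ∀ {m} (f : Fin m → Bool) {i : Fin m} → i ∈ tabulate f → f i ≡ true
∈tabulate⁻ f {i} i∈ = trans (≡-sym (lookup∘tabulate f i)) ([]=⇒lookup i∈)

any-true⁺ : ∀ {m} (g : Fin m → Bool) (i : Fin m) → g i ≡ true →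
  foldrF _∨_ false g ≡ true
any-true⁺ g zero    gi rewrite gi = refl
any-true⁺ g (suc i) gi with g zero
... | true  = refl
... | false = any-true⁺ (λ j → g (suc j)) i gi

any-true⁻ : ∀ {m} (g : Fin m → Bool) → foldrF _∨_ false g ≡ true →
  ∃ λ i → g i ≡ true
any-true⁻ {suc m} g some with g zero in g0
... | true  = zero , g0
... | false with any-true⁻ (λ j → g (suc j)) some
...   | i , gi = suc i , gi

module _ (G : Graph) where

  ∈N₁⁺ : ∀ {u v} → adj G u v ≡ true → u ∈ N₁ G v
  ∈N₁⁺ {u} {v} a = ∈tabulate⁺ (adj G v) (trans (Graph.sym G v u) a)

  ∈N₁⁻ : ∀ {u v} → u ∈ N₁ G v → adj G u v ≡ true
  ∈N₁⁻ {u} {v} u∈ = trans (Graph.sym G u v) (∈tabulate⁻ (adj G v) u∈)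

  ∈N⁺ : ∀ X {x v} → x ∈ X → adj G x v ≡ true → v ∈ N G X
  ∈N⁺ X {x} {v} x∈X a = ∈tabulate⁺ _ (any-true⁺ _ x (subst (λ b → b ∧ adj G x v ≡ true)
    (≡-sym ([]=⇒lookup x∈X)) a))

  ∈N⁻ : ∀ X {v} → v ∈ N G X → ∃ λ x → x ∈ X × adj G x v ≡ true
  -- (The case lookup X x ≡ false is absurd: the conjunction e would be false.)
  ∈N⁻ X v∈ with any-true⁻ _ (∈tabulate⁻ _ v∈)
  ... | x , e with lookup X x in x∈X
  ...   | true = x , lookup⇒[]= x X x∈X , e

  module _ (A : Subset (n G)) where

    Saturating : ℕ → Subset (n G) → Subset (n G) → Set
    Saturating d S R' =
      ∀ v → v ∈ ∁ A → (N₁ G v ∩ S ⊆ R') ⊎ (d ≤ ∣ N₁ G v ∩ R' ∣)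

    saturating⇒equivalent : ∀ {d S R'} → R' ⊆ S → Saturating d S R' →
      NeighbourEquiv G d A R' S
    saturating⇒equivalent {S = S} R'⊆S sat v v∉A with sat v v∉A
    ... | inj₁ N∩S⊆R' = inj₁ (cong ∣_∣ (⊆-antisym (∩-monoʳ-⊆ (N₁ G v) R'⊆S)
                                         (λ z∈ → x∈p∩q⁺ (proj₁ (x∈p∩q⁻ _ S z∈) , N∩S⊆R' z∈))))
    ... | inj₂ d≤ = inj₂ (d≤ , ≤-trans d≤ (p⊆q⇒∣p∣≤∣q∣ (∩-monoʳ-⊆ (N₁ G v) R'⊆S)))

    Represents : Subset (n G) → Subset (n G) → Set
    Represents S R = N G S ∩ ∁ A ≡ N G R ∩ ∁ A

    neighbour-in-representative : ∀ {S R v} → Represents S R → v ∈ ∁ A →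
      Nonempty (N₁ G v ∩ S) → ∃ λ y → y ∈ N₁ G v × y ∈ R
    neighbour-in-representative {S} {R} {v} rep v∉A (x , x∈N₁∩S)
      with x∈p∩q⁻ (N₁ G v) S x∈N₁∩S
    ... | x∈N₁ , x∈S with ∈N⁻ R (proj₁ (x∈p∩q⁻ (N G R) (∁ A) v∈N[R]∩Ā))
      where
      v∈N[R]∩Ā : v ∈ N G R ∩ ∁ A
      v∈N[R]∩Ā = subst (v ∈_) rep (x∈p∩q⁺ (∈N⁺ S x∈S (∈N₁⁻ x∈N₁) , v∉A))
    ...   | y , y∈R , a = y , ∈N₁⁺ a , y∈R

    -- A vertex whose S-neighbours are not
    -- all covered has, besides its d neighbours in R₁, a neighbour in R; a
    -- vertex without S-neighbours is covered vacuously.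
    saturation-step : ∀ {d S R R₁} → Represents S R → R₁ ⊆ S ∩ ∁ R →
      Saturating d (S ∩ ∁ R) R₁ → Saturating (suc d) S (R ∪ R₁)
    saturation-step {_} {S} {R} {R₁} rep R₁⊆S∖R sat v v∉A with sat v v∉A
    ... | inj₁ covered = inj₁ (∩-⊆-∪ (N₁ G v) S covered)
    ... | inj₂ d≤ with nonempty? (N₁ G v ∩ S)
    ...   | no  empty = inj₁ (λ {z} z∈ → contradiction (z , z∈) empty)
    ...   | yes ne with neighbour-in-representative rep v∉A ne
    ...     | y , y∈N₁ , y∈R = inj₂ (≤-trans (s≤s d≤) (p⊂q⇒∣p∣<∣q∣ N∩R₁⊂N∩[R∪R₁]))
      where
      y∉N∩R₁ : y ∉ N₁ G v ∩ R₁
      y∉N∩R₁ y∈ = x∈∁p⇒x∉p (proj₂ (x∈p∩q⁻ S (∁ R) (R₁⊆S∖R (proj₂ (x∈p∩q⁻ _ R₁ y∈))))) y∈R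
      N∩R₁⊂N∩[R∪R₁] : N₁ G v ∩ R₁ ⊂ N₁ G v ∩ (R ∪ R₁)
      N∩R₁⊂N∩[R∪R₁] = ∩-monoʳ-⊆ (N₁ G v) (q⊆p∪q R R₁)
                      , y , x∈p∩q⁺ (y∈N₁ , x∈p∪q⁺ (inj₁ y∈R)) , y∉N∩R₁

    saturating-subset : (k : ℕ) →
      (∀ S → S ⊆ A → Σ (Subset (n G)) λ R → R ⊆ S × ∣ R ∣ ≤ k × Represents S R) →
      ∀ d S → S ⊆ A →
      Σ (Subset (n G)) λ R' → R' ⊆ S × ∣ R' ∣ ≤ d * k × Saturating d S R'
    saturating-subset k rep zero S S⊆A = ⊥ , ⊥⊆ , ≤-reflexive (∣⊥∣≡0 (n G)) , λ _ _ → inj₂ z≤n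
    saturating-subset k rep (suc d) S S⊆A with rep S S⊆A
    ... | R , R⊆S , ∣R∣≤k , S≈R with saturating-subset k rep d (S ∩ ∁ R) (S⊆A ∘ p∩q⊆p S (∁ R))
    ...   | R₁ , R₁⊆S∖R , ∣R₁∣≤dk , sat =
      R ∪ R₁ , R∪R₁⊆S , ≤-trans (∣p∪q∣≤∣p∣+∣q∣ R R₁) (+-mono-≤ ∣R∣≤k ∣R₁∣≤dk)
             , saturation-step S≈R R₁⊆S∖R sat
      where
      R∪R₁⊆S : R ∪ R₁ ⊆ S
      R∪R₁⊆S z∈ = [ R⊆S , p∩q⊆p S (∁ R) ∘ R₁⊆S∖R ]′ (x∈p∪q⁻ R R₁ z∈)

-- Theorem.  The saturating subset of size ≤ d·k is d-neighbour equivalent to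
-- S.
mainTheorem13 : (G : Graph) (A : Subset (n G)) (d k : ℕ) → 1 ≤ d →
    (∀ (S : Subset (n G)) → S ⊆ A →
      Σ (Subset (n G)) λ R → R ⊆ S × ∣ R ∣ ≤ k × N G S ∩ ∁ A ≡ N G R ∩ ∁ A) →
    ∀ (S : Subset (n G)) → S ⊆ A →
      Σ (Subset (n G)) λ R' → R' ⊆ S × ∣ R' ∣ ≤ d * k × NeighbourEquiv G d A R' S
mainTheorem13 G A d k _ representatives S S⊆A
  with saturating-subset G A k representatives d S S⊆A
... | R' , R'⊆S , ∣R'∣≤dk , sat = R' , R'⊆S , ∣R'∣≤dk , saturating⇒equivalent G A R'⊆S sat
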